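{- The system $Y'=(\mathrm{PFO},\to_{\{S\downarrow,M\}})/\stackrel{*}{\leftrightarrow}_{\mathcal{T}}$ is terminating.
   Context: A pfo-formula is a relational first-order formula with no negation ($\wedge,\vee$ binary); $\mathrm{PFO}$ is the class of all pfo-formulas; $\mathrm{free}(\psi)$ is its set of free variables. Rewriting rules (applicable to any subformula occurrence; $\oplus\in\{\wedge,\vee\}$, $Q\in\{\exists,\forall\}$): $A$: $F_1\oplus(F_2\oplus F_3)\to(F_1\oplus F_2)\oplus F_3$ and its converse; $C$: $F_1\oplus F_2\to F_2\oplus F_1$; $O$: $QxQyF\to QyQxF$; $P\!\downarrow$: $\exists x(F_1\wedge F_2)\to(\exists xF_1)\wedge F_2$ and $\forall x(F_1\vee F_2)\to(\forall xF_1)\vee F_2$ whenever $x\notin\mathrm{free}(F_2)$; $P\!\uparrow$: inverse of $P\!\downarrow$; $N$: $QxF\to QyF'$ when $y\notin\mathrm{free}(F)$ and $F'$ arises from $F$ by replacing each free occurrence of $x$ by $y$; $S\!\downarrow$: $\exists x(F_1\vee F_2)\to(\exists xF_1)\vee(\exists xF_2)$ and $\forall x(F_1\wedge F_2)\to(\forall xF_1)\wedge(\forall xF_2)$; $M$: $QxF\to F$ when $x\notin\mathrm{free}(F)$. $\mathcal{T}=\{A,C,O,P\!\downarrow,P\!\uparrow,N\}$. $\to_{\mathcal{R}}$ is the union of the rules in $\mathcal{R}$; $\stackrel{*}{\leftrightarrow}_{\mathcal{R}}$ is the reflexive-transitive closure of $\to_{\mathcal{R}}$ with its inverse. For a system $(D,\to)$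 and equivalence $\equiv$ on $D$, $(D,\to)/\equiv$ is the system on $\equiv$-classes with $C\to C'$ iff some $d\in C$, $d'\in C'$ satisfy $d\to d'$. A system is terminating if there is no infinite chain $d_0\to d_1\to\cdots$. -}

module Defs where

open import Data.Nat using (ℕ; _≟_)
open import Data.List using (List; map)
open import Data.List.Membership.Propositional using (_∈_)
open import Data.Product using (Σ; _×_)
open import Relation.Nullary using (¬_; yes; no)
open import Relation.Binary.PropositionalEquality using (_≡_)
open import Relation.Binary.Construct.Closure.Equivalence using (EqClosure)

Var : Set
Var = ℕ

data Op : Set where
  and or : Op

data Quant : Set where
  ex all : Quant

-- pfo-formulas: relational first-order formulas without negation
-- (atoms R(x₁,…,xₖ), binary ∧/∨, ∃x, ∀x).  PFO = Formula.
data Formula : Set where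
  atom  : (R : ℕ) → (args : List Var) → Formula
  bin   : Op → Formula → Formula → Formula
  quant : Quant → Var → Formula → Formula

data Free (x : Var) : Formula → Set where
  free-atom  : ∀ {R args} → x ∈ args → Free x (atom R args)
  free-binˡ  : ∀ {o F G} → Free x F → Free x (bin o F G)
  free-binʳ  : ∀ {o F G} → Free x G → Free x (bin o F G)
  free-quant : ∀ {q z F} → ¬ (z ≡ x) → Free x F → Free x (quant q z F)

renVar : Var → Var → Var → Var
renVar x y v with v ≟ x
... | yes _ = y
... | no  _ = v

rename : Var → Var → Formula → Formula
rename x y (atom R args) = atom R (map (renVar x y) args)
rename x y (bin o F G)   = bin o (rename x y F) (rename x y G)
rename x y (quant q z F) with z ≟ x
... | yes _ = quant q z F
... | no  _ = quant q z (rename x y F)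

-- the pair (∃,∧) resp. (∀,∨) used in rule P↓, and (∃,∨) resp. (∀,∧) in S↓
pOp : Quant → Op
pOp ex  = and
pOp all = or

sOp : Quant → Op
sOp ex  = or
sOp all = and

data TRoot : Formula → Formula → Set where
  ruleA   : ∀ {o F₁ F₂ F₃} →
            TRoot (bin o F₁ (bin o F₂ F₃)) (bin o (bin o F₁ F₂) F₃)
  ruleA⁻  : ∀ {o F₁ F₂ F₃} →
            TRoot (bin o (bin o F₁ F₂) F₃) (bin o F₁ (bin o F₂ F₃))
  ruleC   : ∀ {o F₁ F₂} → TRoot (bin o F₁ F₂) (bin o F₂ F₁)
  ruleO   : ∀ {q x y F} → TRoot (quant q x (quant q y F)) (quant q y (quant q x F))
  ruleP↓  : ∀ {q x F₁ F₂} → ¬ Free x F₂ →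
            TRoot (quant q x (bin (pOp q) F₁ F₂)) (bin (pOp q) (quant q x F₁) F₂)
  ruleP↑  : ∀ {q x F₁ F₂} → ¬ Free x F₂ →
            TRoot (bin (pOp q) (quant q x F₁) F₂) (quant q x (bin (pOp q) F₁ F₂))
  ruleN   : ∀ {q x y F} → ¬ Free y F →
            TRoot (quant q x F) (quant q y (rename x y F))

data SMRoot : Formula → Formula → Set where
  ruleS↓  : ∀ {q x F₁ F₂} →
            SMRoot (quant q x (bin (sOp q) F₁ F₂)) (bin (sOp q) (quant q x F₁) (quant q x F₂))
  ruleM   : ∀ {q x F} → ¬ Free x F → SMRoot (quant q x F) F

data Step (R : Formula → Formula → Set) : Formula → Formula → Set where
  root   : ∀ {F G} → R F G → Step R F G
  inBinˡ : ∀ {o F F' G} → Step R F F' → Step R (bin o F G) (bin o F' G)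
  inBinʳ : ∀ {o F G G'} → Step R G G' → Step R (bin o F G) (bin o F G')
  inQuant : ∀ {q x F F'} → Step R F F' → Step R (quant q x F) (quant q x F')

_→T_ : Formula → Formula → Set
_→T_ = Step TRoot

_→SM_ : Formula → Formula → Set
_→SM_ = Step SMRoot

_≈T_ : Formula → Formula → Set
_≈T_ = EqClosure _→T_

-- Step of the quotient system (PFO, →_{S↓,M}) / *↔_T, on representatives:
-- [F] → [G] iff some d ≈T F and d' ≈T G satisfy d →SM d'
_→Y'_ : Formula → Formula → Set
F →Y' G = Σ Formula λ d → Σ Formula λ d' → (F ≈T d) × (d →SM d') × (d' ≈T G)

Terminating : {D : Set} → (D → D → Set) → Set
Terminating {D} _⇒_ = ¬ (Σ (ℕ → D) λ d → ∀ i → d i ⇒ d (ℕ.suc i))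
  where import Data.Nat as ℕ

{-# OPTIONS --safe #-}
module Submission where

open import Defs
open import Data.Nat
open import Data.Nat.Properties
open import Data.Product using (_,_)
open import Relation.Nullary using (yes; no)
open import Relation.Binary.Core using (Rel; _⇒_)
open import Relation.Binary.Structures using (IsEquivalence)
open import Relation.Binary.PropositionalEquality
open import Relation.Binary.Construct.Closure.Equivalence using (fold)
open import Algebra.Properties.CommutativeSemigroup +-commutativeSemigroup using (interchange)

-- Let the size of a formula count its atoms and connectives, ignoring
-- quantifiers. An ∃ weighs 3ⁿ, where n is the size of the subformula directly
-- below the nearest ∨ above it (the whole formula if there is none); dually a ∀
-- weighs 3ⁿ with ∧ in place of ∨. The rules of 𝒯 only regroup ∧- and ∨-clusters
-- and move quantifiers inside them, so they preserve all these sizes and hence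
-- the total weight. M deletes a quantifier, and S↓ replaces a quantifier of
-- weight 3ⁿ, n > n₁ + n₂, by two of weights 3^n₁ and 3^n₂, which weigh less.
-- So the total weight strictly decreases along Y'.

measure⇒terminating : {D : Set} {_⇒ᴰ_ : Rel D _} (f : D → ℕ) →
                      (∀ x y → x ⇒ᴰ y → f y < f x) → Terminating _⇒ᴰ_
measure⇒terminating f decreasing (d , chain) =
  n≮n (f (d 0)) (m+n≤o⇒n≤o (f (d (suc (f (d 0))))) (descent (suc (f (d 0)))))
  where
  descent : ∀ i → f (d i) + i ≤ f (d 0)
  descent zero    = ≤-reflexive (+-identityʳ (f (d 0)))
  descent (suc i) = begin
    f (d (suc i)) + suc i  ≡⟨ +-suc (f (d (suc i))) i ⟩
    suc (f (d (suc i))) + i ≤⟨ +-monoˡ-≤ i (decreasing (d i) (d (suc i)) (chain i)) ⟩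
    f (d i) + i            ≤⟨ descent i ⟩
    f (d 0)                ∎
    where open ≤-Reasoning

3^m+3^n<3^[1+m+n] : ∀ m n → 3 ^ m + 3 ^ n < 3 ^ suc (m + n)
3^m+3^n<3^[1+m+n] m n = begin-strict
  3 ^ m + 3 ^ n  ≤⟨ +-mono-≤ (^-monoʳ-≤ 3 (m≤m+n m n)) (^-monoʳ-≤ 3 (m≤n+m n m)) ⟩
  k + k          <⟨ +-monoʳ-< k (m<m+n k (≤-trans 0<k (m≤m+n k 0))) ⟩
  k + (k + (k + 0)) ∎
  where
  open ≤-Reasoning
  k = 3 ^ (m + n)
  0<k : 0 < k
  0<k = m^n>0 3 (m + n)

record Congruent (_∼_ : Rel Formula _) : Set where
  field
    bin-congˡ   : ∀ {o F F' G} → F ∼ F' → bin o F G ∼ bin o F' G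
    bin-congʳ   : ∀ {o F G G'} → G ∼ G' → bin o F G ∼ bin o F G'
    quant-cong  : ∀ {q x F F'} → F ∼ F' → quant q x F ∼ quant q x F'

Step⇒ : ∀ {R _∼_} → Congruent _∼_ → R ⇒ _∼_ → Step R ⇒ _∼_
Step⇒ cong∼ R⇒∼ (root r)    = R⇒∼ r
Step⇒ cong∼ R⇒∼ (inBinˡ s)  = Congruent.bin-congˡ cong∼ (Step⇒ cong∼ R⇒∼ s)
Step⇒ cong∼ R⇒∼ (inBinʳ s)  = Congruent.bin-congʳ cong∼ (Step⇒ cong∼ R⇒∼ s)
Step⇒ cong∼ R⇒∼ (inQuant s) = Congruent.quant-cong cong∼ (Step⇒ cong∼ R⇒∼ s)

size : Formula → ℕ
size (atom R args)  = 1
size (bin o F G)    = suc (size F + size G)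
size (quant q x F)  = size F

record Ranks : Set where
  constructor ranks
  field
    exRank allRank : ℕ
open Ranks

rank : Quant → Ranks → ℕ
rank ex  = exRank
rank all = allRank

-- Passing to a child of size n of an o-node resets the rank of the quantifier
-- that S↓ distributes over o.
enter : Op → ℕ → Ranks → Ranks
enter and n r = ranks (exRank r) n
enter or  n r = ranks n (allRank r)

rank-enter-sOp : ∀ q n r → rank q (enter (sOp q) n r) ≡ n
rank-enter-sOp ex  n r = refl
rank-enter-sOp all n r = refl

rank-enter-pOp : ∀ q n r → rank q (enter (pOp q) n r) ≡ rank q r
rank-enter-pOp ex  n r = refl
rank-enter-pOp all n r = refl

enter-enter : ∀ o m n r → enter o m (enter o n r) ≡ enter o m r
enter-enter and m n r = refl
enter-enter or  m n r = refl

weight : Formula → Ranks → ℕ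
weight (atom R args) r = 0
weight (bin o F G)   r = weight F (enter o (size F) r) + weight G (enter o (size G) r)
weight (quant q x F) r = 3 ^ rank q r + weight F r

‖_‖ : Formula → ℕ
‖ F ‖ = weight F (ranks (size F) (size F))

_≤ᴿ_ : ℕ → Ranks → Set
n ≤ᴿ r = ∀ q → n ≤ rank q r

enter-≤ᴿ : ∀ o {m n r} → n ≤ m → m ≤ᴿ r → n ≤ᴿ enter o n r
enter-≤ᴿ and n≤m m≤r ex  = ≤-trans n≤m (m≤r ex)
enter-≤ᴿ and n≤m m≤r all = ≤-refl
enter-≤ᴿ or  n≤m m≤r ex  = ≤-refl
enter-≤ᴿ or  n≤m m≤r all = ≤-trans n≤m (m≤r all)

size-binˡ : ∀ o F G → size F ≤ size (bin o F G)
size-binˡ o F G = m≤n⇒m≤1+n (m≤m+n (size F) (size G))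

size-binʳ : ∀ o F G → size G ≤ size (bin o F G)
size-binʳ o F G = m≤n⇒m≤1+n (m≤n+m (size G) (size F))

record _≋_ (F G : Formula) : Set where
  constructor _,_
  field
    size-≡   : size F ≡ size G
    weight-≡ : ∀ r → weight F r ≡ weight G r
open _≋_

≋-isEquivalence : IsEquivalence _≋_
≋-isEquivalence = record
  { refl  = refl , λ r → refl
  ; sym   = λ (p , w) → sym p , λ r → sym (w r)
  ; trans = λ (p , w) (p' , w') → trans p p' , λ r → trans (w r) (w' r)
  }

open IsEquivalence ≋-isEquivalence using () renaming (refl to ≋-refl; sym to ≋-sym)

≋-bin : ∀ {o F F' G G'} → F ≋ F' → G ≋ G' → bin o F G ≋ bin o F' G'
≋-bin {o} {F} {F'} {G} {G'} F≋F' G≋G' =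
  cong suc (cong₂ _+_ (size-≡ F≋F') (size-≡ G≋G')) ,
  λ r → cong₂ _+_ (child F≋F' r) (child G≋G' r)
  where
  child : ∀ {H H'} → H ≋ H' → ∀ r → weight H (enter o (size H) r) ≡ weight H' (enter o (size H') r)
  child {H} {H'} (p , w) r = trans (w _) (cong (λ n → weight H' (enter o n r)) p)

≋-quant : ∀ {q x y F F'} → F ≋ F' → quant q x F ≋ quant q y F'
≋-quant {q} (p , w) = p , λ r → cong (3 ^ rank q r +_) (w r)

≋-congruent : Congruent _≋_
≋-congruent = record
  { bin-congˡ  = λ F≋F' → ≋-bin F≋F' ≋-refl
  ; bin-congʳ  = ≋-bin ≋-refl
  ; quant-cong = ≋-quant
  }

rename-≋ : ∀ x y F → rename x y F ≋ F
rename-≋ x y (atom R args) = refl , λ r → refl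
rename-≋ x y (bin o F G)   = ≋-bin (rename-≋ x y F) (rename-≋ x y G)
rename-≋ x y (quant q z F) with z ≟ x
... | yes _ = refl , λ r → refl
... | no  _ = ≋-quant (rename-≋ x y F)

A-≋ : ∀ o F₁ F₂ F₃ → bin o F₁ (bin o F₂ F₃) ≋ bin o (bin o F₁ F₂) F₃
A-≋ o F₁ F₂ F₃ = cong suc (sizes (size F₁) (size F₂) (size F₃)) , λ r → begin
  w₁ (enter o s₁ r) + (w₂ (enter o s₂ (enter o s₂₃ r)) + w₃ (enter o s₃ (enter o s₂₃ r)))
    ≡⟨ cong₂ (λ r₂ r₃ → w₁ (enter o s₁ r) + (w₂ r₂ + w₃ r₃)) (enter-enter o s₂ s₂₃ r) (enter-enter o s₃ s₂₃ r) ⟩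
  w₁ (enter o s₁ r) + (w₂ (enter o s₂ r) + w₃ (enter o s₃ r))
    ≡⟨ +-assoc (w₁ (enter o s₁ r)) _ _ ⟨
  w₁ (enter o s₁ r) + w₂ (enter o s₂ r) + w₃ (enter o s₃ r)
    ≡⟨ cong₂ (λ r₁ r₂ → w₁ r₁ + w₂ r₂ + w₃ (enter o s₃ r)) (enter-enter o s₁ s₁₂ r) (enter-enter o s₂ s₁₂ r) ⟨
  w₁ (enter o s₁ (enter o s₁₂ r)) + w₂ (enter o s₂ (enter o s₁₂ r)) + w₃ (enter o s₃ r) ∎
  where
  open ≡-Reasoning
  w₁ = weight F₁; w₂ = weight F₂; w₃ = weight F₃
  s₁ = size F₁; s₂ = size F₂; s₃ = size F₃
  s₁₂ = size (bin o F₁ F₂); s₂₃ = size (bin o F₂ F₃)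
  sizes : ∀ a b c → a + suc (b + c) ≡ suc (a + b) + c
  sizes a b c = trans (+-suc a (b + c)) (cong suc (sym (+-assoc a b c)))

P↓-≋ : ∀ q x F₁ F₂ → quant q x (bin (pOp q) F₁ F₂) ≋ bin (pOp q) (quant q x F₁) F₂
P↓-≋ q x F₁ F₂ = refl , λ r → begin
  3 ^ rank q r + (w₁ (e₁ r) + w₂ (e₂ r))   ≡⟨ +-assoc (3 ^ rank q r) (w₁ (e₁ r)) (w₂ (e₂ r)) ⟨
  3 ^ rank q r + w₁ (e₁ r) + w₂ (e₂ r)     ≡⟨ cong (λ n → 3 ^ n + w₁ (e₁ r) + w₂ (e₂ r)) (rank-enter-pOp q (size F₁) r) ⟨
  3 ^ rank q (e₁ r) + w₁ (e₁ r) + w₂ (e₂ r) ∎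
  where
  open ≡-Reasoning
  w₁ = weight F₁; w₂ = weight F₂
  e₁ = enter (pOp q) (size F₁); e₂ = enter (pOp q) (size F₂)

TRoot⇒≋ : TRoot ⇒ _≋_
TRoot⇒≋ (ruleA {o} {F₁} {F₂} {F₃})  = A-≋ o F₁ F₂ F₃
TRoot⇒≋ (ruleA⁻ {o} {F₁} {F₂} {F₃}) = ≋-sym (A-≋ o F₁ F₂ F₃)
TRoot⇒≋ (ruleC {o} {F₁} {F₂})       =
  cong suc (+-comm (size F₁) (size F₂)) , λ r → +-comm (weight F₁ (enter o (size F₁) r)) _
TRoot⇒≋ ruleO                       = refl , λ r → refl
TRoot⇒≋ (ruleP↓ {q} {x} {F₁} {F₂} _) = P↓-≋ q x F₁ F₂
TRoot⇒≋ (ruleP↑ {q} {x} {F₁} {F₂} _) = ≋-sym (P↓-≋ q x F₁ F₂)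
TRoot⇒≋ (ruleN {q} {x} {y} {F} _)   = ≋-sym (≋-quant (rename-≋ x y F))

≈T⇒≋ : _≈T_ ⇒ _≋_
≈T⇒≋ = fold ≋-isEquivalence (Step⇒ ≋-congruent TRoot⇒≋)

-- S↓ only loses weight when the rank of its quantifier exceeds the size of the
-- formula it distributes over.
record _≻_ (F G : Formula) : Set where
  constructor _,_
  field
    size-≡   : size F ≡ size G
    weight-< : ∀ r → size F ≤ᴿ r → weight G r < weight F r
open _≻_

≻-child : ∀ o {F F' H r} → F ≻ F' → size F ≤ size H → size H ≤ᴿ r →
          weight F' (enter o (size F') r) < weight F (enter o (size F) r)
≻-child o {F} {F'} {r = r} (p , w) F≤H H≤r =
  subst (λ n → weight F' (enter o n r) < weight F (enter o (size F) r)) p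
    (w _ (enter-≤ᴿ o F≤H H≤r))

≻-congruent : Congruent _≻_
≻-congruent = record
  { bin-congˡ  = λ {o} {F} {F'} {G} F≻F' → cong suc (cong (_+ size G) (size-≡ F≻F')) , λ r le →
      +-monoˡ-< (weight G (enter o (size G) r)) (≻-child o {H = bin o F G} F≻F' (size-binˡ o F G) le)
  ; bin-congʳ  = λ {o} {F} {G} {G'} G≻G' → cong suc (cong (size F +_) (size-≡ G≻G')) , λ r le →
      +-monoʳ-< (weight F (enter o (size F) r)) (≻-child o {H = bin o F G} G≻G' (size-binʳ o F G) le)
  ; quant-cong = λ {q} (p , w) → p , λ r le → +-monoʳ-< (3 ^ rank q r) (w r le)
  }

S↓-≻ : ∀ q x F₁ F₂ → quant q x (bin (sOp q) F₁ F₂) ≻ bin (sOp q) (quant q x F₁) (quant q x F₂)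
S↓-≻ q x F₁ F₂ = refl , λ r le → begin-strict
  (3 ^ rank q (e₁ r) + w₁ (e₁ r)) + (3 ^ rank q (e₂ r) + w₂ (e₂ r))
    ≡⟨ cong₂ (λ m n → (3 ^ m + w₁ (e₁ r)) + (3 ^ n + w₂ (e₂ r))) (rank-enter-sOp q s₁ r) (rank-enter-sOp q s₂ r) ⟩
  (3 ^ s₁ + w₁ (e₁ r)) + (3 ^ s₂ + w₂ (e₂ r))
    ≡⟨ interchange (3 ^ s₁) (w₁ (e₁ r)) (3 ^ s₂) (w₂ (e₂ r)) ⟩
  (3 ^ s₁ + 3 ^ s₂) + (w₁ (e₁ r) + w₂ (e₂ r))
    <⟨ +-monoˡ-< _ (<-≤-trans (3^m+3^n<3^[1+m+n] s₁ s₂) (^-monoʳ-≤ 3 (le q))) ⟩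
  3 ^ rank q r + (w₁ (e₁ r) + w₂ (e₂ r)) ∎
  where
  open ≤-Reasoning
  w₁ = weight F₁; w₂ = weight F₂
  s₁ = size F₁; s₂ = size F₂
  e₁ = enter (sOp q) s₁; e₂ = enter (sOp q) s₂

SMRoot⇒≻ : SMRoot ⇒ _≻_
SMRoot⇒≻ (ruleS↓ {q} {x} {F₁} {F₂}) = S↓-≻ q x F₁ F₂
SMRoot⇒≻ (ruleM {q} {x} {F} _)      = refl , λ r _ → m<n+m (weight F r) (m^n>0 3 (rank q r))

→SM⇒≻ : _→SM_ ⇒ _≻_
→SM⇒≻ = Step⇒ ≻-congruent SMRoot⇒≻

→Y'-decreasing : ∀ F G → F →Y' G → ‖ G ‖ < ‖ F ‖
→Y'-decreasing F G (d , d' , F≈d , d→d' , d'≈G) = begin-strict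
  weight G  (ranks (size G) (size G))  ≡⟨ weight-≡ d'≋G _ ⟨
  weight d' (ranks (size G) (size G))  ≡⟨ cong (λ n → weight d' (ranks n n)) size-F≡G ⟨
  weight d' (ranks (size F) (size F))  <⟨ weight-< d≻d' _ (λ { ex → size-d≤F ; all → size-d≤F }) ⟩
  weight d  (ranks (size F) (size F))  ≡⟨ weight-≡ F≋d _ ⟨
  weight F  (ranks (size F) (size F))  ∎
  where
  open ≤-Reasoning
  F≋d = ≈T⇒≋ F≈d
  d≻d' = →SM⇒≻ d→d'
  d'≋G = ≈T⇒≋ d'≈G
  size-F≡G : size F ≡ size G
  size-F≡G = trans (size-≡ F≋d) (trans (size-≡ d≻d') (size-≡ d'≋G))
  size-d≤F : size d ≤ size F
  size-d≤F = ≤-reflexive (sym (size-≡ F≋d))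

lemma7p2 : Terminating _→Y'_
lemma7p2 = measure⇒terminating ‖_‖ →Y'-decreasing
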